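{- Let $p$ be a prime, $r\ge0$, $A=\sum_{i=0}^ra_ip^i$, $B=\sum_{i=0}^rb_ip^i$ with $a_i,b_i\in\{0,\ldots,p-1\}$, and $AB=\sum_{i=0}^{2r+1}e_ip^i$ with $e_i\in\{0,\ldots,p-1\}$; set $a_i=b_i=0$ for $i>r$. Then $e_0\equiv a_0b_0\pmod p$ and for $1\le t\le 2r+1$, $$e_t\equiv\sum_{\underline{\underline k}\in\mathbb K^{(t+1)^2},\ \|\underline{\underline k}\|=p^t}\pi_{\underline{\underline k}}(\underline a,\underline b)\pmod p,$$ where $\underline a=(a_0,\ldots,a_t)$, $\underline b=(b_0,\ldots,b_t)$.
   Context: $\mathbb K=\{\underline k=(k_1,\ldots,k_{p-1})\in\mathbb Z_{\ge0}^{p-1}:\sum_lk_l\le p-1\}$. For $\underline k\ne\underline0$, $\pi_{\underline k}(x,y)=\frac{y(y-1)\cdots(y-\sum_lk_l+1)}{k_1!\cdots k_{p-1}!}\prod_{l=1}^{p-1}\bigl(\frac{x(x-1)\cdots(x-l+1)}{l!}\bigr)^{k_l}$, a polynomial over $\mathbb F_p$, and $\pi_{\underline0}=1$. $\mathbb K^{(t+1)^2}$ is the set of families $\underline{\underline k}=(\underline k_{i,j})_{0\le i,j\le t}$ with $\underline k_{i,j}=(k_{i,j,1},\ldots,k_{i,j,p-1})\in\mathbb K$. For such a family, $\pi_{\underline{\underline k}}(\underline x,\underline y)=\prod_{0\le i,j\le t}\pi_{\underline k_{i,j}}(x_i,y_j)$ and $\|\underline{\underline k}\|=\sum_{0\le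 i,j\le t}\bigl(\sum_{l=1}^{p-1}lk_{i,j,l}\bigr)p^{i+j}$. Integers are identified with their residues in $\mathbb F_p$ when evaluating. -}

module Defs where

open import Data.Nat using (ℕ; zero; suc; _+_; _*_; _∸_; _^_; _≤?_; _≟_; _/_; _!)
open import Data.Nat.ListAction using (sum)
open import Data.Fin using (Fin; toℕ)
open import Data.List as L using (List; []; _∷_; [_]; upTo; concatMap; filter)
open import Data.Vec as V using (Vec; lookup; tabulate)

vsum : ∀ {n} → Vec ℕ n → ℕ
vsum = V.foldr _ _+_ 0

vprod : ∀ {n} → Vec ℕ n → ℕ
vprod = V.foldr _ _*_ 1

sumTo : ℕ → (ℕ → ℕ) → ℕ
sumTo n f = sum (L.map f (upTo (suc n)))

digitSum : ℕ → ℕ → (ℕ → ℕ) → ℕ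
digitSum p n d = sumTo n (λ i → d i * p ^ i)

digitVec : (ℕ → ℕ) → (t : ℕ) → Vec ℕ (suc t)
digitVec d t = tabulate (λ i → d (toℕ i))

ff : ℕ → ℕ → ℕ
ff y zero    = 1
ff y (suc s) = ff y s * (y ∸ s)

-- division (only ever used here where it is exact and the divisor is nonzero)
divN : ℕ → ℕ → ℕ
divN m zero    = 0
divN m (suc n) = m / suc n

-- an element k = (k_1,…,k_{n}) ; position i : Fin n corresponds to l = i+1
-- π_k(x,y) = y(y-1)⋯(y-Σk+1)/(k_1!⋯k_n!) · ∏_l (x(x-1)⋯(x-l+1)/l!)^{k_l}
piK : ∀ {n} → Vec ℕ n → ℕ → ℕ → ℕ
piK k x y =
  divN (ff y (vsum k)) (vprod (V.map _! k))
  * vprod (tabulate (λ i → divN (ff x (suc (toℕ i))) (suc (toℕ i) !) ^ lookup k i))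

weight : ∀ {n} → Vec ℕ n → ℕ
weight k = vsum (tabulate (λ i → suc (toℕ i) * lookup k i))

-- families (k_{i,j})_{0 ≤ i,j ≤ t}, stored as F[i][j]
Fam : ℕ → ℕ → Set
Fam p t = Vec (Vec (Vec ℕ (p ∸ 1)) (suc t)) (suc t)

piFam : ∀ {p t} → Fam p t → Vec ℕ (suc t) → Vec ℕ (suc t) → ℕ
piFam F xs ys = vprod (tabulate (λ i → vprod (tabulate (λ j →
  piK (lookup (lookup F i) j) (lookup xs i) (lookup ys j)))))

normFam : ∀ {t} → (p : ℕ) → Fam p t → ℕ
normFam p F = vsum (tabulate (λ i → vsum (tabulate (λ j →
  weight (lookup (lookup F i) j) * p ^ (toℕ i + toℕ j)))))

vecsOver : {A : Set} → List A → (n : ℕ) → List (Vec A n)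
vecsOver xs zero    = [ V.[] ]
vecsOver xs (suc n) = concatMap (λ x → L.map (x V.∷_) (vecsOver xs n)) xs

-- the set 𝕂 (for the prime p), enumerated without repetition
KList : (p : ℕ) → List (Vec ℕ (p ∸ 1))
KList p = filter (λ k → vsum k ≤? p ∸ 1) (vecsOver (upTo p) (p ∸ 1))

-- 𝕂^{(t+1)^2}, enumerated without repetition
families : (p t : ℕ) → List (Fam p t)
families p t = vecsOver (vecsOver (KList p) (suc t)) (suc t)

rhsSum : (p t : ℕ) → Vec ℕ (suc t) → Vec ℕ (suc t) → ℕ
rhsSum p t xs ys =
  sum (L.map (λ F → piFam {p} {t} F xs ys) (filter (λ F → normFam p F ≟ p ^ t) (families p t)))

module Submission where

-- In 𝔽ₚ[X], (1 + X)^(p^s) = 1 + X^(p^s), since p divides (p^s C k) for 0 < k < p^s. Hence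
-- (1 + X)^(M + p^(t+1) R) agrees with (1 + X)^M below degree p^(t+1), and the coefficient of X^(p^t)
-- in (1 + X)^(E + p^t d) with E < p^t is d: the t-th base-p digit of N is (N C p^t) mod p, and this
-- only depends on N mod p^(t+1). For N = AB we may thus replace A and B by their truncations Aₜ, Bₜ,
-- and (1 + X)^(Aₜ Bₜ) = ∏_{i,j ≤ t} ((1 + X^(p^(i+j)))^(a_i))^(b_j). Expanding every factor with the
-- multinomial theorem ((1 + u)^x)^y = Σ_{k ∈ 𝕂} π_k(x, y) u^(Σ l k_l), valid for x, y < p, and
-- multiplying out, the coefficient of X^(p^t) is the sum of π over the families of norm p^t.
-- For t = 0 the same argument gives e₀ ≡ (A₀ B₀ C 1) = a₀ b₀.

open import Algebra.Bundles using (CommutativeSemiring)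
open import Data.Nat.Base using (ℕ; NonZero)

module FallingFactorial where

  open import Data.Nat
  open import Data.Nat.Properties
  open import Data.Nat.DivMod using (m*n/n≡m)
  open import Data.Nat.Combinatorics using (_C_; k>n⇒nCk≡0; nCk+nC[k+1]≡[n+1]C[k+1])
  open import Algebra.Properties.CommutativeSemigroup *-commutativeSemigroup using (x∙yz≈y∙xz)
  open import Relation.Binary.PropositionalEquality
  open import Relation.Nullary using (yes; no)
  open import Defs using (ff; divN)
  open ≡-Reasoning

  ff-suc : ∀ x l → ff (suc x) (suc l) ≡ suc x * ff x l
  ff-suc x zero    = trans (*-identityˡ (suc x)) (sym (*-identityʳ (suc x)))
  ff-suc x (suc l) = trans (cong (_* (x ∸ l)) (ff-suc x l)) (*-assoc (suc x) (ff x l) (x ∸ l))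

  ff-+ : ∀ y a b → ff y (a + b) ≡ ff y a * ff (y ∸ a) b
  ff-+ y a zero    = trans (cong (ff y) (+-identityʳ a)) (sym (*-identityʳ (ff y a)))
  ff-+ y a (suc b) = begin
    ff y (a + suc b)                       ≡⟨ cong (ff y) (+-suc a b) ⟩
    ff y (a + b) * (y ∸ (a + b))           ≡⟨ cong₂ _*_ (ff-+ y a b) (sym (∸-+-assoc y a b)) ⟩
    ff y a * ff (y ∸ a) b * (y ∸ a ∸ b)    ≡⟨ *-assoc (ff y a) _ _ ⟩
    ff y a * ff (y ∸ a) (suc b)            ∎

  ff≡C*! : ∀ x l → ff x l ≡ (x C l) * l !
  ff≡C*! x       zero    = refl
  ff≡C*! zero    (suc l) = begin
    ff 0 l * (0 ∸ l)          ≡⟨ cong (ff 0 l *_) (0∸n≡0 l) ⟩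
    ff 0 l * 0                ≡⟨ *-zeroʳ (ff 0 l) ⟩
    0                         ≡⟨ cong (_* (suc l) !) (k>n⇒nCk≡0 {0} {suc l} (s≤s z≤n)) ⟨
    (0 C suc l) * (suc l) !   ∎
  ff≡C*! (suc x) (suc l) with l ≤? x
  ... | yes l≤x = begin
    ff (suc x) (suc l)                                   ≡⟨ ff-suc x l ⟩
    suc x * ff x l                                       ≡⟨ cong (_* ff x l) (m+[n∸m]≡n (s≤s l≤x)) ⟨
    (suc l + (x ∸ l)) * ff x l                           ≡⟨ *-distribʳ-+ (ff x l) (suc l) (x ∸ l) ⟩
    suc l * ff x l + (x ∸ l) * ff x l                    ≡⟨ cong₂ _+_ (cong (suc l *_) (ff≡C*! x l))
                                                              (trans (*-comm (x ∸ l) (ff x l)) (ff≡C*! x (suc l))) ⟩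
    suc l * ((x C l) * l !) + (x C suc l) * (suc l) !    ≡⟨ cong (_+ (x C suc l) * (suc l) !) (x∙yz≈y∙xz (suc l) (x C l) (l !)) ⟩
    (x C l) * (suc l) ! + (x C suc l) * (suc l) !        ≡⟨ *-distribʳ-+ ((suc l) !) (x C l) (x C suc l) ⟨
    (x C l + x C suc l) * (suc l) !                      ≡⟨ cong (_* (suc l) !) (nCk+nC[k+1]≡[n+1]C[k+1] x l) ⟩
    (suc x C suc l) * (suc l) !                          ∎
  ... | no l≰x = begin
    ff (suc x) (suc l)            ≡⟨ ff-suc x l ⟩
    suc x * ff x l                ≡⟨ cong (suc x *_) (ff≡C*! x l) ⟩
    suc x * ((x C l) * l !)       ≡⟨ cong (λ c → suc x * (c * l !)) (k>n⇒nCk≡0 (≰⇒> l≰x)) ⟩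
    suc x * 0                     ≡⟨ *-zeroʳ (suc x) ⟩
    0                             ≡⟨ cong (_* (suc l) !) (k>n⇒nCk≡0 (s≤s (≰⇒> l≰x))) ⟨
    (suc x C suc l) * (suc l) !   ∎

  [1+n]C[1+k]*[1+k]≡[1+n]*nCk : ∀ n k → (suc n C suc k) * suc k ≡ suc n * (n C k)
  [1+n]C[1+k]*[1+k]≡[1+n]*nCk n k = *-cancelʳ-≡ _ _ (k !) {{k !≢0}} (begin
    (suc n C suc k) * suc k * k !   ≡⟨ *-assoc (suc n C suc k) (suc k) (k !) ⟩
    (suc n C suc k) * (suc k) !     ≡⟨ ff≡C*! (suc n) (suc k) ⟨
    ff (suc n) (suc k)              ≡⟨ ff-suc n k ⟩
    suc n * ff n k                  ≡⟨ cong (suc n *_) (ff≡C*! n k) ⟩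
    suc n * ((n C k) * k !)         ≡⟨ *-assoc (suc n) (n C k) (k !) ⟨
    suc n * (n C k) * k !           ∎)

  divN[m*n,n]≡m : ∀ m n → .{{NonZero n}} → divN (m * n) n ≡ m
  divN[m*n,n]≡m m (suc n) = m*n/n≡m m (suc n)

  divN[ff,!]≡C : ∀ x l → divN (ff x l) (l !) ≡ x C l
  divN[ff,!]≡C x l = trans (cong (λ z → divN z (l !)) (ff≡C*! x l)) (divN[m*n,n]≡m (x C l) (l !) {{l !≢0}})

module PrimePowerBinomial where

  open import Data.Nat
  open import Data.Nat.Properties
  open import Data.Nat.Divisibility
  open import Data.Nat.Combinatorics using (_C_)
  open import Data.Nat.Primality using (Prime; euclidsLemma; prime⇒nonZero)
  open import Algebra.Properties.CommutativeSemigroup *-commutativeSemigroup using (x∙yz≈y∙xz)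
  open import Relation.Binary.PropositionalEquality
  open import Relation.Nullary using (¬_; yes; no; contradiction)
  open import Data.Sum using (inj₁; inj₂)
  open FallingFactorial using ([1+n]C[1+k]*[1+k]≡[1+n]*nCk)

  module _ {p} (prime : Prime p) where

    p^s∣m*c⇒p^s∣m : ∀ s {m c} → ¬ p ∣ c → p ^ s ∣ m * c → p ^ s ∣ m
    p^s∣m*c⇒p^s∣m zero    _   _ = 1∣ _
    p^s∣m*c⇒p^s∣m (suc s) {m} {c} p∤c p^[1+s]∣mc
      with euclidsLemma m c prime (∣-trans (m∣m*n (p ^ s)) p^[1+s]∣mc)
    ... | inj₂ p∣c = contradiction p∣c p∤c
    ... | inj₁ (divides m′ refl) = subst (p ^ suc s ∣_) (*-comm p m′)
          (*-monoʳ-∣ p (p^s∣m*c⇒p^s∣m s p∤c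
            (*-cancelˡ-∣ p {{prime⇒nonZero prime}}
              (subst (p ^ suc s ∣_) (trans (*-assoc m′ p c) (x∙yz≈y∙xz m′ p c)) p^[1+s]∣mc))))

    -- (1+k) (p^s C 1+k) = p^s ((p^s - 1) C k), so p ∤ (p^s C 1+k) would force p^s ∣ 1+k < p^s.
    p∣[p^s]C[1+k] : ∀ s {n k} → suc n ≡ p ^ s → k < n → p ∣ (suc n C suc k)
    p∣[p^s]C[1+k] s {n} {k} 1+n≡p^s k<n with p ∣? (suc n C suc k)
    ... | yes p∣C = p∣C
    ... | no  p∤C = contradiction (∣⇒≤ p^s∣1+k) (<⇒≱ (subst (suc k <_) 1+n≡p^s (s≤s k<n)))
      where
      p^s∣1+k : p ^ s ∣ suc k
      p^s∣1+k = p^s∣m*c⇒p^s∣m s p∤C (subst (_∣ suc k * (suc n C suc k)) 1+n≡p^s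
        (divides (n C k) (trans (*-comm (suc k) _)
          (trans ([1+n]C[1+k]*[1+k]≡[1+n]*nCk n k) (*-comm (suc n) (n C k))))))

module Multinomial where

  open import Data.Nat
  open import Data.Nat.Properties
  open import Data.Nat.Combinatorics using (_C_; k>n⇒nCk≡0)
  open import Data.Fin using (toℕ)
  open import Data.Vec as V using (Vec; []; _∷_; lookup; tabulate)
  open import Data.Vec.Properties using (tabulate-cong)
  open import Function using (_∘_)
  open import Algebra.Properties.CommutativeSemigroup *-commutativeSemigroup using (interchange)
  open import Relation.Binary.PropositionalEquality
  open import Relation.Nullary using (yes; no)
  open import Defs using (ff; divN; vsum; vprod; piK; weight)
  open FallingFactorial
  open ≡-Reasoning

  multinomial : ∀ {m} → ℕ → Vec ℕ m → ℕ
  multinomial y []      = 1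
  multinomial y (j ∷ k) = (y C j) * multinomial (y ∸ j) k

  binomialPowers : ∀ {m} → ℕ → (ℕ → ℕ) → Vec ℕ m → ℕ
  binomialPowers x g []      = 1
  binomialPowers x g (j ∷ k) = (x C g 0) ^ j * binomialPowers x (g ∘ suc) k

  weightWith : ∀ {m} → (ℕ → ℕ) → Vec ℕ m → ℕ
  weightWith g []      = 0
  weightWith g (j ∷ k) = g 0 * j + weightWith (g ∘ suc) k

  ff≡multinomial*∏! : ∀ {m} y (k : Vec ℕ m) → ff y (vsum k) ≡ multinomial y k * vprod (V.map _! k)
  ff≡multinomial*∏! y []      = refl
  ff≡multinomial*∏! y (j ∷ k) = begin
    ff y (j + vsum k)                                          ≡⟨ ff-+ y j (vsum k) ⟩
    ff y j * ff (y ∸ j) (vsum k)                               ≡⟨ cong₂ _*_ (ff≡C*! y j) (ff≡multinomial*∏! (y ∸ j) k) ⟩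
    (y C j) * j ! * (multinomial (y ∸ j) k * vprod (V.map _! k)) ≡⟨ interchange (y C j) (j !) _ _ ⟩
    (y C j) * multinomial (y ∸ j) k * (j ! * vprod (V.map _! k)) ∎

  ∏!≢0 : ∀ {m} (k : Vec ℕ m) → NonZero (vprod (V.map _! k))
  ∏!≢0 []      = _
  ∏!≢0 (j ∷ k) = m*n≢0 (j !) (vprod (V.map _! k)) {{j !≢0}} {{∏!≢0 k}}

  binomialPowers-tabulate : ∀ {m} x g (k : Vec ℕ m) →
    vprod (tabulate (λ i → (x C g (toℕ i)) ^ lookup k i)) ≡ binomialPowers x g k
  binomialPowers-tabulate x g []      = refl
  binomialPowers-tabulate x g (j ∷ k) = cong ((x C g 0) ^ j *_) (binomialPowers-tabulate x (g ∘ suc) k)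

  weight≡weightWith-suc : ∀ {m} (k : Vec ℕ m) → weight k ≡ weightWith suc k
  weight≡weightWith-suc = go suc
    where
    go : ∀ {m} g (k : Vec ℕ m) → vsum (tabulate (λ i → g (toℕ i) * lookup k i)) ≡ weightWith g k
    go g []      = refl
    go g (j ∷ k) = cong (g 0 * j +_) (go (g ∘ suc) k)

  piK≡multinomial*binomialPowers : ∀ {m} (k : Vec ℕ m) x y → piK k x y ≡ multinomial y k * binomialPowers x suc k
  piK≡multinomial*binomialPowers k x y = cong₂ _*_
    (trans (cong (λ z → divN z (vprod (V.map _! k))) (ff≡multinomial*∏! y k))
           (divN[m*n,n]≡m (multinomial y k) _ {{∏!≢0 k}}))
    (trans (cong vprod (tabulate-cong (λ i → cong (_^ lookup k i) (divN[ff,!]≡C x (suc (toℕ i))))))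
           (binomialPowers-tabulate x suc k))

  multinomial-vanishes : ∀ {m} y (k : Vec ℕ m) → y < vsum k → multinomial y k ≡ 0
  multinomial-vanishes y (j ∷ k) y<j+Σk with j ≤? y
  ... | yes j≤y = trans (cong ((y C j) *_) (multinomial-vanishes (y ∸ j) k
                    (+-cancelˡ-< j (y ∸ j) (vsum k) (subst (_< j + vsum k) (sym (m+[n∸m]≡n j≤y)) y<j+Σk))))
                        (*-zeroʳ (y C j))
  ... | no  j≰y = cong (_* multinomial (y ∸ j) k) (k>n⇒nCk≡0 (≰⇒> j≰y))

module SemiringSums {c ℓ} (S : CommutativeSemiring c ℓ) where

  open import Data.Nat as ℕ using (ℕ; zero; suc; _∸_; _<_; z≤n; s≤s; _≤?_)
  import Data.Nat.Properties as ℕ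
  open import Data.Nat.Combinatorics using (_C_; k>n⇒nCk≡0)
  open import Data.Fin using (Fin; toℕ) renaming (zero to fzero; suc to fsuc)
  open import Data.List as L using (List; []; _∷_; _++_; applyUpTo; upTo; concatMap; filter)
  import Data.List.Properties as L
  open import Data.Vec as V using (Vec; []; _∷_; lookup; tabulate)
  open import Function using (_∘_)
  open import Relation.Binary.PropositionalEquality as ≡ using (_≡_)
  open import Relation.Nullary using (¬_; yes; no)
  open import Relation.Unary using (Pred; Decidable)
  open import Level using (0ℓ)
  open import Defs using (vsum; vecsOver; KList; piK; weight)
  open Multinomial

  open CommutativeSemiring S
  open import Algebra.Properties.Semiring.Exp semiring
  open import Algebra.Properties.Semiring.Mult semiring
  open import Algebra.Properties.CommutativeMonoid.Mult +-commutativeMonoid using (×-distrib-+)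
  open import Algebra.Properties.Semiring.Sum semiring using (sum-syntax; sum⁺-syntax; sum-cong-≋; sum-replicate; sum-replicate-zero)
  open import Algebra.Properties.CommutativeSemiring.Binomial S using () renaming (theorem to binomial-theorem)
  open import Algebra.Properties.CommutativeSemigroup +-commutativeSemigroup using (x∙yz≈y∙xz)
  import Algebra.Properties.CommutativeSemigroup ℕ.*-commutativeSemigroup as ℕ*
  open import Relation.Binary.Reasoning.Setoid setoid

  lsum : List Carrier → Carrier
  lsum = L.foldr _+_ 0#

  lsum-cong : ∀ {A : Set} (xs : List A) {f g : A → Carrier} → (∀ x → f x ≈ g x) →
              lsum (L.map f xs) ≈ lsum (L.map g xs)
  lsum-cong []       f≈g = refl
  lsum-cong (x ∷ xs) f≈g = +-cong (f≈g x) (lsum-cong xs f≈g)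

  lsum-++ : ∀ xs ys → lsum (xs ++ ys) ≈ lsum xs + lsum ys
  lsum-++ []       ys = sym (+-identityˡ _)
  lsum-++ (x ∷ xs) ys = trans (+-congˡ (lsum-++ xs ys)) (sym (+-assoc _ _ _))

  lsum-concatMap : ∀ {A B : Set} (f : B → Carrier) (g : A → List B) xs →
                   lsum (L.map f (concatMap g xs)) ≈ lsum (L.map (λ x → lsum (L.map f (g x))) xs)
  lsum-concatMap f g []       = refl
  lsum-concatMap f g (x ∷ xs) = begin
    lsum (L.map f (g x ++ concatMap g xs))                  ≡⟨ ≡.cong lsum (L.map-++ f (g x) (concatMap g xs)) ⟩
    lsum (L.map f (g x) ++ L.map f (concatMap g xs))        ≈⟨ lsum-++ (L.map f (g x)) _ ⟩
    lsum (L.map f (g x)) + lsum (L.map f (concatMap g xs))  ≈⟨ +-congˡ (lsum-concatMap f g xs) ⟩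
    lsum (L.map (λ x → lsum (L.map f (g x))) (x ∷ xs))      ∎

  lsum-*ˡ : ∀ {A : Set} a (f : A → Carrier) xs → a * lsum (L.map f xs) ≈ lsum (L.map (λ x → a * f x) xs)
  lsum-*ˡ a f []       = zeroʳ a
  lsum-*ˡ a f (x ∷ xs) = trans (distribˡ a _ _) (+-congˡ (lsum-*ˡ a f xs))

  lsum-*ʳ : ∀ {A : Set} a (f : A → Carrier) xs → lsum (L.map f xs) * a ≈ lsum (L.map (λ x → f x * a) xs)
  lsum-*ʳ a f xs = trans (*-comm _ a) (trans (lsum-*ˡ a f xs) (lsum-cong xs (λ x → *-comm a (f x))))

  lsum-× : ∀ {A : Set} n (f : A → Carrier) xs → n × lsum (L.map f xs) ≈ lsum (L.map (λ x → n × f x) xs)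
  lsum-× n f []       = trans (sym (sum-replicate n)) (sum-replicate-zero n)
  lsum-× n f (x ∷ xs) = trans (×-distrib-+ _ _ n) (+-congˡ (lsum-× n f xs))

  lsum-filter : ∀ {A : Set} {P : Pred A 0ℓ} (P? : Decidable P) (f : A → Carrier) xs →
                (∀ x → ¬ P x → f x ≈ 0#) → lsum (L.map f (filter P? xs)) ≈ lsum (L.map f xs)
  lsum-filter P? f []       f≈0 = refl
  lsum-filter P? f (x ∷ xs) f≈0 with P? x
  ... | yes _  = +-congˡ (lsum-filter P? f xs f≈0)
  ... | no ¬Px = trans (lsum-filter P? f xs f≈0) (trans (sym (+-identityˡ _)) (+-congʳ (sym (f≈0 x ¬Px))))

  lsum-applyUpTo : ∀ {A : Set} (f : A → Carrier) g n → lsum (L.map f (applyUpTo g n)) ≡ ∑[ i < n ] f (g (toℕ i))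
  lsum-applyUpTo f g zero    = ≡.refl
  lsum-applyUpTo f g (suc n) = ≡.cong (f (g 0) +_) (lsum-applyUpTo f (g ∘ suc) n)

  ∑-pad : ∀ n m (f : ℕ → Carrier) → (∀ j → n < j → f j ≈ 0#) → n < m →
          ∑[ k ≤ n ] f (toℕ k) ≈ ∑[ k < m ] f (toℕ k)
  ∑-pad zero    (suc m) f f≈0 _         = +-congˡ (sym (trans
    (sum-cong-≋ {m} {λ k → f (suc (toℕ k))} (λ k → f≈0 (suc (toℕ k)) (s≤s z≤n))) (sum-replicate-zero m)))
  ∑-pad (suc n) (suc m) f f≈0 (s≤s n<m) = +-congˡ (∑-pad n m (f ∘ suc) (λ j n<j → f≈0 (suc j) (s≤s n<j)) n<m)

  -- Every exponent n < m is expanded over the same index list upTo m, as in the enumeration KList.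
  binomial-upTo : ∀ {n m} x y → n < m →
    (x + y) ^ n ≈ lsum (L.map (λ j → (n C j) × (x ^ j * y ^ (n ∸ j))) (upTo m))
  binomial-upTo {n} {m} x y n<m = begin
    (x + y) ^ n                ≈⟨ binomial-theorem n x y ⟩
    ∑[ k ≤ n ] term (toℕ k)    ≈⟨ ∑-pad n m term (λ j n<j → ×-congˡ {x ^ j * y ^ (n ∸ j)} (k>n⇒nCk≡0 n<j)) n<m ⟩
    ∑[ k < m ] term (toℕ k)    ≡⟨ lsum-applyUpTo term (λ j → j) m ⟨
    lsum (L.map term (upTo m)) ∎
    where
    term : ℕ → Carrier
    term j = (n C j) × (x ^ j * y ^ (n ∸ j))

  1#^n≈1# : ∀ n → 1# ^ n ≈ 1#
  1#^n≈1# zero    = refl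
  1#^n≈1# (suc n) = trans (*-identityˡ _) (1#^n≈1# n)

  ×-^ : ∀ n a j → (n × a) ^ j ≈ (n ℕ.^ j) × a ^ j
  ×-^ n a zero    = sym (×-homo-1 1#)
  ×-^ n a (suc j) = begin
    (n × a) * (n × a) ^ j             ≈⟨ *-congˡ (×-^ n a j) ⟩
    (n × a) * ((n ℕ.^ j) × a ^ j)     ≈⟨ ×-assoc-* n a _ ⟩
    n × (a * ((n ℕ.^ j) × a ^ j))     ≈⟨ ×-congʳ n (×-comm-* (n ℕ.^ j) a (a ^ j)) ⟩
    n × ((n ℕ.^ j) × (a * a ^ j))     ≈⟨ ×-assocˡ _ n (n ℕ.^ j) ⟩
    (n ℕ.* n ℕ.^ j) × (a * a ^ j)     ∎

  ×-*-× : ∀ m n a b → (m × a) * (n × b) ≈ (m ℕ.* n) × (a * b)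
  ×-*-× m n a b = trans (×-assoc-* m a _) (trans (×-congʳ m (×-comm-* n a b)) (×-assocˡ _ m n))

  module _ (x : ℕ) (u : Carrier) where

    private
      F : ℕ → Carrier
      F j = (x C j) × u ^ j

      term : ∀ {m} → (ℕ → ℕ) → ℕ → Vec ℕ m → Carrier
      term g y k = (multinomial y k ℕ.* binomialPowers x g k) × u ^ weightWith g k

      term-∷ : ∀ {m} g y j (k : Vec ℕ m) →
               (y C j) × (F (g 0) ^ j * term (g ∘ suc) (y ∸ j) k) ≈ term g y (j ∷ k)
      term-∷ g y j k = begin
        (y C j) × (F (g 0) ^ j * term (g ∘ suc) (y ∸ j) k)
          ≈⟨ ×-congʳ (y C j) (*-congʳ (trans (×-^ (x C g 0) (u ^ g 0) j) (×-congʳ ((x C g 0) ℕ.^ j) (^-assocʳ u (g 0) j)))) ⟩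
        (y C j) × (((x C g 0) ℕ.^ j) × u ^ (g 0 ℕ.* j) * (M ℕ.* B) × u ^ W)
          ≈⟨ ×-congʳ (y C j) (×-*-× ((x C g 0) ℕ.^ j) (M ℕ.* B) (u ^ (g 0 ℕ.* j)) (u ^ W)) ⟩
        (y C j) × (((x C g 0) ℕ.^ j ℕ.* (M ℕ.* B)) × (u ^ (g 0 ℕ.* j) * u ^ W))
          ≈⟨ ×-assocˡ _ (y C j) _ ⟩
        ((y C j) ℕ.* ((x C g 0) ℕ.^ j ℕ.* (M ℕ.* B))) × (u ^ (g 0 ℕ.* j) * u ^ W)
          ≈⟨ ×-cong (≡.trans (≡.cong ((y C j) ℕ.*_) (ℕ*.x∙yz≈y∙xz ((x C g 0) ℕ.^ j) M B)) (≡.sym (ℕ.*-assoc (y C j) M _)))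
                    (sym (^-homo-* u (g 0 ℕ.* j) W)) ⟩
        term g y (j ∷ k) ∎
        where
        M B W : ℕ
        M = multinomial (y ∸ j) k
        B = binomialPowers x (g ∘ suc) k
        W = weightWith (g ∘ suc) k

      -- term g y k is the summand of (1 + Σ_{i<m} F (g i))^y with k_i factors F (g i); the summands
      -- are split off one at a time with the binomial theorem.
      expand : ∀ n m g y → y < n →
               (1# + lsum (L.map F (applyUpTo g m))) ^ y ≈ lsum (L.map (term g y) (vecsOver (upTo n) m))
      expand n zero    g y _   = trans (^-congˡ y (+-identityʳ 1#))
        (trans (1#^n≈1# y) (sym (trans (+-identityʳ _) (×-homo-1 1#))))
      expand n (suc m) g y y<n = begin
        (1# + (F (g 0) + R)) ^ y
          ≈⟨ ^-congˡ y (x∙yz≈y∙xz 1# (F (g 0)) R) ⟩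
        (F (g 0) + (1# + R)) ^ y
          ≈⟨ binomial-upTo (F (g 0)) (1# + R) y<n ⟩
        lsum (L.map (λ j → (y C j) × (F (g 0) ^ j * (1# + R) ^ (y ∸ j))) (upTo n))
          ≈⟨ lsum-cong (upTo n) column ⟩
        lsum (L.map (λ j → lsum (L.map (term g y) (L.map (j ∷_) vs))) (upTo n))
          ≈⟨ lsum-concatMap (term g y) (λ j → L.map (j ∷_) vs) (upTo n) ⟨
        lsum (L.map (term g y) (vecsOver (upTo n) (suc m))) ∎
        where
        R : Carrier
        R = lsum (L.map F (applyUpTo (g ∘ suc) m))
        vs : List (Vec ℕ m)
        vs = vecsOver (upTo n) m
        column : ∀ j → (y C j) × (F (g 0) ^ j * (1# + R) ^ (y ∸ j)) ≈
                       lsum (L.map (term g y) (L.map (j ∷_) vs))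
        column j = begin
          (y C j) × (F (g 0) ^ j * (1# + R) ^ (y ∸ j))
            ≈⟨ ×-congʳ (y C j) (*-congˡ (expand n m (g ∘ suc) (y ∸ j) (ℕ.≤-<-trans (ℕ.m∸n≤m y j) y<n))) ⟩
          (y C j) × (F (g 0) ^ j * lsum (L.map (term (g ∘ suc) (y ∸ j)) vs))
            ≈⟨ ×-congʳ (y C j) (lsum-*ˡ _ _ vs) ⟩
          (y C j) × lsum (L.map (λ k → F (g 0) ^ j * term (g ∘ suc) (y ∸ j) k) vs)
            ≈⟨ lsum-× (y C j) _ vs ⟩
          lsum (L.map (λ k → (y C j) × (F (g 0) ^ j * term (g ∘ suc) (y ∸ j) k)) vs)
            ≈⟨ lsum-cong vs (term-∷ g y j) ⟩
          lsum (L.map (λ k → term g y (j ∷ k)) vs)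
            ≡⟨ ≡.cong lsum (L.map-∘ vs) ⟩
          lsum (L.map (term g y) (L.map (j ∷_) vs)) ∎

    multinomial-theorem : ∀ {n y} → x < n → y < n →
      ((1# + u) ^ x) ^ y ≈ lsum (L.map (λ k → piK k x y × u ^ weight k) (KList n))
    multinomial-theorem {suc b} {y} x<1+b y<1+b = begin
      ((1# + u) ^ x) ^ y                            ≈⟨ ^-congˡ y 1+u^x≈1+ΣF ⟩
      (1# + lsum (L.map F (applyUpTo suc b))) ^ y   ≈⟨ expand (suc b) b suc y y<1+b ⟩
      lsum (L.map (term suc y) vectors)             ≈⟨ lsum-cong vectors term≈G ⟨
      lsum (L.map G vectors)                        ≈⟨ lsum-filter (λ k → vsum k ≤? b) G vectors G≈0 ⟨
      lsum (L.map G (KList (suc b)))                ∎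
      where
      vectors : List (Vec ℕ b)
      vectors = vecsOver (upTo (suc b)) b
      G : Vec ℕ b → Carrier
      G k = piK k x y × u ^ weight k
      term≈G : ∀ k → G k ≈ term suc y k
      term≈G k = ×-cong (piK≡multinomial*binomialPowers k x y) (^-congʳ u (weight≡weightWith-suc k))
      G≈0 : ∀ k → ¬ vsum k ℕ.≤ b → G k ≈ 0#
      G≈0 k Σk≰b = ×-congˡ (≡.trans (piK≡multinomial*binomialPowers k x y)
        (≡.cong (ℕ._* binomialPowers x suc k) (multinomial-vanishes y k (ℕ.<-≤-trans y<1+b (ℕ.≰⇒> Σk≰b)))))
      1+u^x≈1+ΣF : (1# + u) ^ x ≈ 1# + lsum (L.map F (applyUpTo suc b))
      1+u^x≈1+ΣF = begin
        (1# + u) ^ x   ≈⟨ ^-congˡ x (+-comm 1# u) ⟩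
        (u + 1#) ^ x   ≈⟨ binomial-upTo u 1# x<1+b ⟩
        lsum (L.map (λ j → (x C j) × (u ^ j * 1# ^ (x ∸ j))) (upTo (suc b)))
          ≈⟨ +-cong (trans (×-homo-1 _) (trans (*-identityˡ _) (1#^n≈1# x)))
                    (lsum-cong (applyUpTo suc b) (λ j → ×-congʳ (x C j) (trans (*-congˡ (1#^n≈1# (x ∸ j))) (*-identityʳ _)))) ⟩
        1# + lsum (L.map F (applyUpTo suc b)) ∎

  product : ∀ {n} → Vec Carrier n → Carrier
  product = V.foldr _ _*_ 1#

  product-cong : ∀ n {f g : Fin n → Carrier} → (∀ i → f i ≈ g i) → product (tabulate f) ≈ product (tabulate g)
  product-cong zero    f≈g = refl
  product-cong (suc n) f≈g = *-cong (f≈g fzero) (product-cong n (f≈g ∘ fsuc))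

  product-of-lsums : ∀ {A : Set} (xs : List A) n (g : Fin n → A → Carrier) →
    product (tabulate (λ i → lsum (L.map (g i) xs))) ≈
    lsum (L.map (λ v → product (tabulate (λ i → g i (lookup v i)))) (vecsOver xs n))
  product-of-lsums xs zero    g = sym (+-identityʳ 1#)
  product-of-lsums {A} xs (suc n) g = begin
    lsum (L.map (g fzero) xs) * product (tabulate (λ i → lsum (L.map (g (fsuc i)) xs)))
      ≈⟨ *-congˡ (product-of-lsums xs n (g ∘ fsuc)) ⟩
    lsum (L.map (g fzero) xs) * lsum (L.map H vs)
      ≈⟨ trans (lsum-*ʳ _ (g fzero) xs) (lsum-cong xs (λ a → lsum-*ˡ (g fzero a) H vs)) ⟩
    lsum (L.map (λ a → lsum (L.map (λ v → g fzero a * H v) vs)) xs)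
      ≡⟨ ≡.cong lsum (L.map-cong (λ a → ≡.cong lsum (L.map-∘ vs)) xs) ⟩
    lsum (L.map (λ a → lsum (L.map G (L.map (a ∷_) vs))) xs)
      ≈⟨ lsum-concatMap G (λ a → L.map (a ∷_) vs) xs ⟨
    lsum (L.map G (vecsOver xs (suc n))) ∎
    where
    vs : List (Vec A n)
    vs = vecsOver xs n
    H : Vec A n → Carrier
    H v = product (tabulate (λ i → g (fsuc i) (lookup v i)))
    G : Vec A (suc n) → Carrier
    G v = product (tabulate (λ i → g i (lookup v i)))

  ^-vsum : ∀ a n (h : Fin n → ℕ) → a ^ vsum (tabulate h) ≈ product (tabulate (λ i → a ^ h i))
  ^-vsum a zero    h = refl
  ^-vsum a (suc n) h = trans (^-homo-* a (h fzero) _) (*-congˡ (^-vsum a n (h ∘ fsuc)))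

module Polynomial where

  open import Data.Nat
  open import Data.Nat.Properties
  open import Algebra.Properties.CommutativeSemigroup +-commutativeSemigroup using (interchange)
  open import Function using (_∘_)
  open import Relation.Binary.PropositionalEquality
  open import Relation.Nullary using (yes; no; contradiction)
  open ≡-Reasoning

  Poly : Set
  Poly = ℕ → ℕ

  conv : Poly → Poly → Poly
  conv f g zero    = f 0 * g 0
  conv f g (suc n) = f 0 * g (suc n) + conv (f ∘ suc) g n

  monomial : ℕ → ℕ → Poly
  monomial c zero    zero    = c
  monomial c zero    (suc n) = 0
  monomial c (suc e) zero    = 0
  monomial c (suc e) (suc n) = monomial c e n

  conv-congˡ : ∀ {f f′} g → (∀ i → f i ≡ f′ i) → ∀ n → conv f g n ≡ conv f′ g n
  conv-congˡ g f≡f′ zero    = cong (_* g 0) (f≡f′ 0)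
  conv-congˡ g f≡f′ (suc n) = cong₂ _+_ (cong (_* g (suc n)) (f≡f′ 0)) (conv-congˡ g (f≡f′ ∘ suc) n)

  conv-congʳ-≤ : ∀ f {g g′} n → (∀ i → i ≤ n → g i ≡ g′ i) → conv f g n ≡ conv f g′ n
  conv-congʳ-≤ f zero    g≡g′ = cong (f 0 *_) (g≡g′ 0 z≤n)
  conv-congʳ-≤ f (suc n) g≡g′ = cong₂ _+_ (cong (f 0 *_) (g≡g′ (suc n) ≤-refl))
    (conv-congʳ-≤ (f ∘ suc) n (λ i i≤n → g≡g′ i (m≤n⇒m≤1+n i≤n)))

  conv-zeroˡ : ∀ {f} g → (∀ i → f i ≡ 0) → ∀ n → conv f g n ≡ 0
  conv-zeroˡ g f≡0 zero    rewrite f≡0 0 = refl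
  conv-zeroˡ g f≡0 (suc n) rewrite f≡0 0 = conv-zeroˡ g (f≡0 ∘ suc) n

  conv-distribʳ : ∀ f h g n → conv (λ i → f i + h i) g n ≡ conv f g n + conv h g n
  conv-distribʳ f h g zero    = *-distribʳ-+ (g 0) (f 0) (h 0)
  conv-distribʳ f h g (suc n) = begin
    (f 0 + h 0) * g (suc n) + conv (λ i → f (suc i) + h (suc i)) g n
      ≡⟨ cong₂ _+_ (*-distribʳ-+ (g (suc n)) (f 0) (h 0)) (conv-distribʳ (f ∘ suc) (h ∘ suc) g n) ⟩
    (f 0 * g (suc n) + h 0 * g (suc n)) + (conv (f ∘ suc) g n + conv (h ∘ suc) g n)
      ≡⟨ interchange (f 0 * g (suc n)) _ _ _ ⟩
    conv f g (suc n) + conv h g (suc n) ∎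

  conv-*ˡ : ∀ c f g n → conv (λ i → c * f i) g n ≡ c * conv f g n
  conv-*ˡ c f g zero    = *-assoc c (f 0) (g 0)
  conv-*ˡ c f g (suc n) = trans (cong₂ _+_ (*-assoc c (f 0) (g (suc n))) (conv-*ˡ c (f ∘ suc) g n))
                                (sym (*-distribˡ-+ c (f 0 * g (suc n)) _))

  conv-suc : ∀ f g n → conv f g (suc n) ≡ conv f (g ∘ suc) n + f (suc n) * g 0
  conv-suc f g zero    = refl
  conv-suc f g (suc n) = trans (cong (f 0 * g (suc (suc n)) +_) (conv-suc (f ∘ suc) g n))
                               (sym (+-assoc (f 0 * g (suc (suc n))) _ _))

  conv-comm : ∀ f g n → conv f g n ≡ conv g f n
  conv-comm f g zero    = *-comm (f 0) (g 0)
  conv-comm f g (suc n) = begin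
    f 0 * g (suc n) + conv (f ∘ suc) g n  ≡⟨ cong₂ _+_ (*-comm (f 0) (g (suc n))) (conv-comm (f ∘ suc) g n) ⟩
    g (suc n) * f 0 + conv g (f ∘ suc) n  ≡⟨ +-comm (g (suc n) * f 0) _ ⟩
    conv g (f ∘ suc) n + g (suc n) * f 0  ≡⟨ conv-suc g f n ⟨
    conv g f (suc n)                      ∎

  conv-assoc : ∀ f g h n → conv (conv f g) h n ≡ conv f (conv g h) n
  conv-assoc f g h zero    = *-assoc (f 0) (g 0) (h 0)
  conv-assoc f g h (suc n) = begin
    f 0 * g 0 * h (suc n) + conv (conv f g ∘ suc) h n
      ≡⟨ cong (f 0 * g 0 * h (suc n) +_) (trans (conv-distribʳ (λ i → f 0 * g (suc i)) (conv (f ∘ suc) g) h n)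
            (cong₂ _+_ (conv-*ˡ (f 0) (g ∘ suc) h n) (conv-assoc (f ∘ suc) g h n))) ⟩
    f 0 * g 0 * h (suc n) + (f 0 * conv (g ∘ suc) h n + conv (f ∘ suc) (conv g h) n)
      ≡⟨ +-assoc (f 0 * g 0 * h (suc n)) _ _ ⟨
    (f 0 * g 0 * h (suc n) + f 0 * conv (g ∘ suc) h n) + conv (f ∘ suc) (conv g h) n
      ≡⟨ cong (_+ conv (f ∘ suc) (conv g h) n)
           (trans (cong (_+ f 0 * conv (g ∘ suc) h n) (*-assoc (f 0) (g 0) (h (suc n))))
                  (sym (*-distribˡ-+ (f 0) (g 0 * h (suc n)) _))) ⟩
    f 0 * conv g h (suc n) + conv (f ∘ suc) (conv g h) n ∎

  conv-identityˡ : ∀ g n → conv (monomial 1 0) g n ≡ g n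
  conv-identityˡ g zero    = +-identityʳ (g 0)
  conv-identityˡ g (suc n) = trans (cong₂ _+_ (+-identityʳ (g (suc n))) (conv-zeroˡ g (λ _ → refl) n)) (+-identityʳ _)

  conv-last : ∀ h g m → (∀ i → i < m → h i ≡ 0) → conv h g m ≡ h m * g 0
  conv-last h g zero    h≡0 = refl
  conv-last h g (suc m) h≡0 = trans (cong (λ c → c * g (suc m) + conv (h ∘ suc) g m) (h≡0 0 (s≤s z≤n)))
    (conv-last (h ∘ suc) g m (λ i i<m → h≡0 (suc i) (s≤s i<m)))

  monomial-≡ : ∀ c e → monomial c e e ≡ c
  monomial-≡ c zero    = refl
  monomial-≡ c (suc e) = monomial-≡ c e

  monomial-≢ : ∀ c e n → e ≢ n → monomial c e n ≡ 0
  monomial-≢ c zero    zero    e≢n = contradiction refl e≢n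
  monomial-≢ c zero    (suc n) e≢n = refl
  monomial-≢ c (suc e) zero    e≢n = refl
  monomial-≢ c (suc e) (suc n) e≢n = monomial-≢ c e n (e≢n ∘ cong suc)

  *-monomial : ∀ c d e n → c * monomial d e n ≡ monomial (c * d) e n
  *-monomial c d zero    zero    = refl
  *-monomial c d zero    (suc n) = *-zeroʳ c
  *-monomial c d (suc e) zero    = *-zeroʳ c
  *-monomial c d (suc e) (suc n) = *-monomial c d e n

  monomial-shift : ∀ c e f n → monomial c (e + f) (e + n) ≡ monomial c f n
  monomial-shift c zero    f n = refl
  monomial-shift c (suc e) f n = monomial-shift c e f n

  conv-monomial : ∀ c e g n → conv (monomial c e) g (e + n) ≡ c * g n
  conv-monomial c zero    g zero    = refl
  conv-monomial c zero    g (suc n) = trans (cong (c * g (suc n) +_) (conv-zeroˡ g (λ _ → refl) n)) (+-identityʳ _)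
  conv-monomial c (suc e) g n       = conv-monomial c e g n

  conv-monomial-< : ∀ c e g n → n < e → conv (monomial c e) g n ≡ 0
  conv-monomial-< c (suc e) g zero    _         = refl
  conv-monomial-< c (suc e) g (suc n) (s≤s n<e) = conv-monomial-< c e g n n<e

  conv-monomial-monomial : ∀ c d e f m → conv (monomial c e) (monomial d f) m ≡ monomial (c * d) (e + f) m
  conv-monomial-monomial c d e f m with e ≤? m
  ... | yes e≤m = begin
    conv (monomial c e) (monomial d f) m                ≡⟨ cong (conv (monomial c e) (monomial d f)) (m+[n∸m]≡n e≤m) ⟨
    conv (monomial c e) (monomial d f) (e + (m ∸ e))    ≡⟨ conv-monomial c e (monomial d f) (m ∸ e) ⟩
    c * monomial d f (m ∸ e)                            ≡⟨ *-monomial c d f (m ∸ e) ⟩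
    monomial (c * d) f (m ∸ e)                          ≡⟨ monomial-shift (c * d) e f (m ∸ e) ⟨
    monomial (c * d) (e + f) (e + (m ∸ e))              ≡⟨ cong (monomial (c * d) (e + f)) (m+[n∸m]≡n e≤m) ⟩
    monomial (c * d) (e + f) m                          ∎
  ... | no e≰m = trans (conv-monomial-< c e (monomial d f) m (≰⇒> e≰m))
    (sym (monomial-≢ (c * d) (e + f) m (λ e+f≡m → e≰m (subst (e ≤_) e+f≡m (m≤m+n e f)))))

module Digits where

  open import Data.Nat
  open import Data.Nat.Properties
  open import Data.Nat.ListAction using (sum)
  open import Data.Nat.ListAction.Properties using (sum-++)
  open import Data.Nat.Tactic.RingSolver using (solve-∀)
  open import Data.Fin as Fin using (Fin; toℕ)
  open import Data.List as L using (applyUpTo; upTo; [_]; _∷ʳ_)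
  import Data.List.Properties as L
  open import Data.Vec using (tabulate)
  open import Data.Vec.Properties using (tabulate-cong)
  open import Data.Product using (Σ; _,_)
  open import Function using (_∘_)
  open import Relation.Nullary using (yes; no)
  open import Relation.Binary.PropositionalEquality hiding ([_])
  open import Defs using (vsum; digitSum)

  digitSum-suc : ∀ p n d → digitSum p (suc n) d ≡ digitSum p n d + d (suc n) * p ^ suc n
  digitSum-suc p n d = begin
    sum (L.map f (upTo (suc (suc n))))              ≡⟨ cong (sum ∘ L.map f) (L.applyUpTo-∷ʳ (λ i → i) (suc n)) ⟨
    sum (L.map f (upTo (suc n) ∷ʳ suc n))           ≡⟨ cong sum (L.map-++ f (upTo (suc n)) [ suc n ]) ⟩
    sum (L.map f (upTo (suc n)) L.++ [ f (suc n) ]) ≡⟨ sum-++ (L.map f (upTo (suc n))) [ f (suc n) ] ⟩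
    digitSum p n d + (f (suc n) + 0)                ≡⟨ cong (digitSum p n d +_) (+-identityʳ (f (suc n))) ⟩
    digitSum p n d + f (suc n)                      ∎
    where
    open ≡-Reasoning
    f : ℕ → ℕ
    f i = d i * p ^ i

  digit<p : ∀ {p r} .{{_ : NonZero p}} (d : ℕ → ℕ) → (∀ i → i ≤ r → d i < p) → (∀ i → r < i → d i ≡ 0) → ∀ i → d i < p
  digit<p {p} {r} d d<p d≡0 i with i ≤? r
  ... | yes i≤r = d<p i i≤r
  ... | no  i≰r = subst (_< p) (sym (d≡0 i (≰⇒> i≰r))) (>-nonZero⁻¹ p)

  digitSum-zero : ∀ p d → digitSum p 0 d ≡ d 0
  digitSum-zero p d = trans (+-identityʳ _) (*-identityʳ (d 0))

  digitSumBelow : ℕ → ℕ → (ℕ → ℕ) → ℕ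
  digitSumBelow p zero    d = 0
  digitSumBelow p (suc t) d = digitSum p t d

  digitSum≡below+top : ∀ p t d → digitSum p t d ≡ digitSumBelow p t d + p ^ t * d t
  digitSum≡below+top p zero    d = x*1+0≡0+1*x (d 0)
    where
    x*1+0≡0+1*x : ∀ x → x * 1 + 0 ≡ 0 + 1 * x
    x*1+0≡0+1*x = solve-∀
  digitSum≡below+top p (suc t) d = trans (digitSum-suc p t d) (cong (digitSum p t d +_) (*-comm (d (suc t)) _))

  digitSum<p^[1+n] : ∀ p n d → (∀ i → i ≤ n → d i < p) → digitSum p n d < p ^ suc n
  digitSum<p^[1+n] p zero    d d<p = subst (_< p * 1) (sym (+-identityʳ (d 0 * 1))) (*-monoˡ-< 1 (d<p 0 z≤n))
  digitSum<p^[1+n] p (suc n) d d<p = begin-strict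
    digitSum p (suc n) d                       ≡⟨ digitSum-suc p n d ⟩
    digitSum p n d + d (suc n) * p ^ suc n     <⟨ +-monoˡ-< _ (digitSum<p^[1+n] p n d (λ i i≤n → d<p i (m≤n⇒m≤1+n i≤n))) ⟩
    suc (d (suc n)) * p ^ suc n                ≤⟨ *-monoˡ-≤ (p ^ suc n) (d<p (suc n) ≤-refl) ⟩
    p * p ^ suc n                              ∎
    where open ≤-Reasoning

  digitSumBelow<p^t : ∀ p t d → (∀ i → i < t → d i < p) → digitSumBelow p t d < p ^ t
  digitSumBelow<p^t p zero    d d<p = s≤s z≤n
  digitSumBelow<p^t p (suc t) d d<p = digitSum<p^[1+n] p t d (λ i i≤t → d<p i (s≤s i≤t))

  digitSum-+ : ∀ p d t M → Σ ℕ λ R → digitSum p (t + M) d ≡ digitSum p t d + p ^ suc t * R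
  digitSum-+ p d t zero    = 0 , trans (cong (λ n → digitSum p n d) (+-identityʳ t)) (sym (x+y*0≡x (digitSum p t d) (p ^ suc t)))
    where
    x+y*0≡x : ∀ x y → x + y * 0 ≡ x
    x+y*0≡x = solve-∀
  digitSum-+ p d t (suc M) with digitSum-+ p d t M
  ... | R , eq = R + d (suc (t + M)) * p ^ M , (begin
    digitSum p (t + suc M) d                                  ≡⟨ cong (λ n → digitSum p n d) (+-suc t M) ⟩
    digitSum p (suc (t + M)) d                                ≡⟨ digitSum-suc p (t + M) d ⟩
    digitSum p (t + M) d + d (suc (t + M)) * p ^ suc (t + M)  ≡⟨ cong₂ _+_ eq (cong (d (suc (t + M)) *_) (^-distribˡ-+-* p (suc t) M)) ⟩
    digitSum p t d + p ^ suc t * R + d (suc (t + M)) * (p ^ suc t * p ^ M)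
      ≡⟨ factor (digitSum p t d) (p ^ suc t) R (d (suc (t + M))) (p ^ M) ⟩
    digitSum p t d + p ^ suc t * (R + d (suc (t + M)) * p ^ M) ∎)
    where
    open ≡-Reasoning
    factor : ∀ D Q R x y → D + Q * R + x * (Q * y) ≡ D + Q * (R + x * y)
    factor = solve-∀

  digitSum-beyond : ∀ p d r → (∀ i → r < i → d i ≡ 0) → ∀ M → digitSum p (r + M) d ≡ digitSum p r d
  digitSum-beyond p d r d≡0 zero    = cong (λ n → digitSum p n d) (+-identityʳ r)
  digitSum-beyond p d r d≡0 (suc M) = begin
    digitSum p (r + suc M) d                                  ≡⟨ cong (λ n → digitSum p n d) (+-suc r M) ⟩
    digitSum p (suc (r + M)) d                                ≡⟨ digitSum-suc p (r + M) d ⟩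
    digitSum p (r + M) d + d (suc (r + M)) * p ^ suc (r + M)  ≡⟨ cong₂ _+_ (digitSum-beyond p d r d≡0 M)
                                                                    (cong (_* p ^ suc (r + M)) (d≡0 (suc (r + M)) (s≤s (m≤m+n r M)))) ⟩
    digitSum p r d + 0                                        ≡⟨ +-identityʳ _ ⟩
    digitSum p r d                                            ∎
    where open ≡-Reasoning

  digitSum-mod-p^[1+t] : ∀ p d r → (∀ i → r < i → d i ≡ 0) → ∀ t →
                         Σ ℕ λ R → digitSum p r d ≡ digitSum p t d + p ^ suc t * R
  digitSum-mod-p^[1+t] p d r d≡0 t with digitSum-+ p d t r
  ... | R , eq = R , trans (sym (digitSum-beyond p d r d≡0 t))
                           (trans (cong (λ n → digitSum p n d) (+-comm r t)) eq)

  digitSum-*-mod-p^[1+t] : ∀ p a b r → (∀ i → r < i → a i ≡ 0) → (∀ i → r < i → b i ≡ 0) → ∀ t →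
    Σ ℕ λ R → digitSum p r a * digitSum p r b ≡ digitSum p t a * digitSum p t b + p ^ suc t * R
  digitSum-*-mod-p^[1+t] p a b r a≡0 b≡0 t
    with digitSum-mod-p^[1+t] p a r a≡0 t | digitSum-mod-p^[1+t] p b r b≡0 t
  ... | R , eqA | S , eqB = _ , trans (cong₂ _*_ eqA eqB) (expand (digitSum p t a) (digitSum p t b) R S (p ^ suc t))
    where
    expand : ∀ x y u v Q → (x + Q * u) * (y + Q * v) ≡ x * y + Q * (u * y + x * v + Q * u * v)
    expand = solve-∀

  sum-applyUpTo : ∀ (f : ℕ → ℕ) g n → sum (L.map f (applyUpTo g n)) ≡ vsum (tabulate {n = n} (λ i → f (g (toℕ i))))
  sum-applyUpTo f g zero    = refl
  sum-applyUpTo f g (suc n) = cong (f (g 0) +_) (sum-applyUpTo f (g ∘ suc) n)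

  vsum-*ˡ : ∀ {n} c (f : Fin n → ℕ) → c * vsum (tabulate f) ≡ vsum (tabulate (λ i → c * f i))
  vsum-*ˡ {zero}  c f = *-zeroʳ c
  vsum-*ˡ {suc n} c f = trans (*-distribˡ-+ c _ _) (cong (c * f Fin.zero +_) (vsum-*ˡ c (f ∘ Fin.suc)))

  vsum-*-vsum : ∀ {m n} (f : Fin m → ℕ) (g : Fin n → ℕ) →
    vsum (tabulate f) * vsum (tabulate g) ≡ vsum (tabulate (λ i → vsum (tabulate (λ j → f i * g j))))
  vsum-*-vsum {zero}  f g = refl
  vsum-*-vsum {suc m} f g = trans (*-distribʳ-+ _ (f Fin.zero) _)
    (cong₂ _+_ (vsum-*ˡ (f Fin.zero) g) (vsum-*-vsum (f ∘ Fin.suc) g))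

  digitSum-*-digitSum : ∀ p t a b → digitSum p t a * digitSum p t b ≡
    vsum (tabulate (λ (i : Fin (suc t)) → vsum (tabulate (λ (j : Fin (suc t)) →
      p ^ (toℕ i + toℕ j) * (a (toℕ i) * b (toℕ j))))))
  digitSum-*-digitSum p t a b = begin
    digitSum p t a * digitSum p t b
      ≡⟨ cong₂ _*_ (sum-applyUpTo (λ i → a i * p ^ i) (λ i → i) (suc t)) (sum-applyUpTo (λ i → b i * p ^ i) (λ i → i) (suc t)) ⟩
    vsum (tabulate A) * vsum (tabulate B)
      ≡⟨ vsum-*-vsum A B ⟩
    vsum (tabulate (λ i → vsum (tabulate (λ j → A i * B j))))
      ≡⟨ cong vsum (tabulate-cong {n = suc t} (λ i → cong vsum (tabulate-cong {n = suc t} (λ j →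
           trans (regroup (a (toℕ i)) (b (toℕ j)) (p ^ toℕ i) (p ^ toℕ j))
                 (cong (_* (a (toℕ i) * b (toℕ j))) (sym (^-distribˡ-+-* p (toℕ i) (toℕ j)))))))) ⟩
    vsum (tabulate (λ (i : Fin (suc t)) → vsum (tabulate (λ (j : Fin (suc t)) →
      p ^ (toℕ i + toℕ j) * (a (toℕ i) * b (toℕ j)))))) ∎
    where
    open ≡-Reasoning
    A B : Fin (suc t) → ℕ
    A i = a (toℕ i) * p ^ toℕ i
    B j = b (toℕ j) * p ^ toℕ j
    regroup : ∀ x y u v → x * u * (y * v) ≡ u * v * (x * y)
    regroup = solve-∀

module PolynomialsModP (p : ℕ) .{{_ : NonZero p}} where

  open import Data.Nat
  open import Data.Nat.Properties
  open import Data.Nat.DivMod using (_%_; %-distribˡ-+; %-distribˡ-*; m*n%n≡0)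
  open import Data.Nat.Divisibility using (n∣m⇒m%n≡0)
  open import Data.Nat.Combinatorics using (_C_; k>n⇒nCk≡0; nCn≡1; nCk+nC[k+1]≡[n+1]C[k+1])
  open import Data.Nat.Primality using (Prime; prime⇒nonTrivial)
  open import Data.Product using (_,_)
  open import Function using (_∘_)
  open import Relation.Binary.PropositionalEquality
  open import Relation.Binary.Structures using (IsEquivalence)
  open import Relation.Binary.Definitions using (tri<; tri≈; tri>)
  open import Relation.Nullary using (contradiction)
  open import Data.Nat.ListAction using (sum)
  open import Data.Fin using (Fin; toℕ) renaming (zero to fzero; suc to fsuc)
  open import Data.List as L using (List; []; _∷_; filter)
  open import Data.Vec as V using (Vec; lookup; tabulate)
  open import Data.Vec.Properties using (tabulate-cong; lookup∘tabulate)
  open import Algebra.Structures.Biased using (isCommutativeSemiringˡ)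
  import Relation.Binary.Reasoning.Setoid as SetoidReasoning
  open import Relation.Nullary using (yes; no)
  open import Relation.Unary using (Decidable)
  open import Defs using (vsum; vprod; piK; weight; KList; Fam; piFam; normFam; families; digitVec; rhsSum; digitSum; vecsOver)
  open Polynomial
  open PrimePowerBinomial using (p∣[p^s]C[1+k])
  open Digits

  infix 4 _≡ₚ_ _≈_
  infixl 6 _⊕_

  _≡ₚ_ : ℕ → ℕ → Set
  a ≡ₚ b = a % p ≡ b % p

  +-cong-≡ₚ : ∀ {a a′ b b′} → a ≡ₚ a′ → b ≡ₚ b′ → a + b ≡ₚ a′ + b′
  +-cong-≡ₚ {a} {a′} {b} {b′} a≡a′ b≡b′ =
    trans (%-distribˡ-+ a b p) (trans (cong₂ (λ x y → (x + y) % p) a≡a′ b≡b′) (sym (%-distribˡ-+ a′ b′ p)))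

  *-cong-≡ₚ : ∀ {a a′ b b′} → a ≡ₚ a′ → b ≡ₚ b′ → a * b ≡ₚ a′ * b′
  *-cong-≡ₚ {a} {a′} {b} {b′} a≡a′ b≡b′ =
    trans (%-distribˡ-* a b p) (trans (cong₂ (λ x y → (x * y) % p) a≡a′ b≡b′) (sym (%-distribˡ-* a′ b′ p)))

  -- Polynomials with ℕ coefficients compared coefficientwise modulo p: a quotient-free model of 𝔽ₚ[X].
  _≈_ : Poly → Poly → Set
  f ≈ g = ∀ n → f n ≡ₚ g n

  ≡⇒≈ : ∀ {f g} → (∀ n → f n ≡ g n) → f ≈ g
  ≡⇒≈ f≡g n = cong (_% p) (f≡g n)

  conv-cong : ∀ {f f′ g g′} → f ≈ f′ → g ≈ g′ → conv f g ≈ conv f′ g′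
  conv-cong f≈f′ g≈g′ zero    = *-cong-≡ₚ (f≈f′ 0) (g≈g′ 0)
  conv-cong f≈f′ g≈g′ (suc n) = +-cong-≡ₚ (*-cong-≡ₚ (f≈f′ 0) (g≈g′ (suc n))) (conv-cong (f≈f′ ∘ suc) g≈g′ n)

  _⊕_ : Poly → Poly → Poly
  (f ⊕ g) n = f n + g n

  𝟙 : Poly
  𝟙 = monomial 1 0

  ≈-isEquivalence : IsEquivalence _≈_
  ≈-isEquivalence = record
    { refl = λ _ → refl ; sym = λ f≈g n → sym (f≈g n) ; trans = λ f≈g g≈h n → trans (f≈g n) (g≈h n) }

  𝔽ₚ[X] : CommutativeSemiring _ _
  𝔽ₚ[X] = record
    { Carrier = Poly ; _≈_ = _≈_ ; _+_ = _⊕_ ; _*_ = conv ; 0# = λ _ → 0 ; 1# = 𝟙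
    ; isCommutativeSemiring = isCommutativeSemiringˡ record
      { +-isCommutativeMonoid = record
        { isMonoid = record
          { isSemigroup = record
            { isMagma = record { isEquivalence = ≈-isEquivalence ; ∙-cong = λ f≈f′ g≈g′ n → +-cong-≡ₚ (f≈f′ n) (g≈g′ n) }
            ; assoc = λ f g h → ≡⇒≈ (λ n → +-assoc (f n) (g n) (h n)) }
          ; identity = (λ f → ≡⇒≈ (λ _ → refl)) , (λ f → ≡⇒≈ (λ n → +-identityʳ (f n))) }
        ; comm = λ f g → ≡⇒≈ (λ n → +-comm (f n) (g n)) }
      ; *-isCommutativeMonoid = record
        { isMonoid = record
          { isSemigroup = record
            { isMagma = record { isEquivalence = ≈-isEquivalence ; ∙-cong = conv-cong }
            ; assoc = λ f g h → ≡⇒≈ (conv-assoc f g h) }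
          ; identity = (λ f → ≡⇒≈ (conv-identityˡ f))
                     , (λ f → ≡⇒≈ (λ n → trans (conv-comm f 𝟙 n) (conv-identityˡ f n))) }
        ; comm = λ f g → ≡⇒≈ (conv-comm f g) }
      ; distribʳ = λ h f g → ≡⇒≈ (conv-distribʳ f g h)
      ; zeroˡ = λ f → ≡⇒≈ (conv-zeroˡ f (λ _ → refl)) } }

  open CommutativeSemiring 𝔽ₚ[X] using () renaming (trans to ≈-trans; sym to ≈-sym)
  open import Algebra.Properties.Semiring.Exp (CommutativeSemiring.semiring 𝔽ₚ[X])
    using (^-congˡ; ^-homo-*; ^-assocʳ) renaming (_^_ to _^ₚ_)
  open import Algebra.Properties.Semiring.Mult (CommutativeSemiring.semiring 𝔽ₚ[X]) using (_×_; ×-congʳ)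
  open SemiringSums 𝔽ₚ[X] using (lsum; lsum-cong; multinomial-theorem; product; product-cong; product-of-lsums; ^-vsum)
  module ≈-Reasoning = SetoidReasoning (CommutativeSemiring.setoid 𝔽ₚ[X])

  ×-coeff : ∀ c f n → (c × f) n ≡ c * f n
  ×-coeff zero    f n = refl
  ×-coeff (suc c) f n = cong (f n +_) (×-coeff c f n)

  ×-monomial : ∀ c e → c × monomial 1 e ≈ monomial c e
  ×-monomial c e = ≡⇒≈ (λ n → trans (×-coeff c (monomial 1 e) n)
    (trans (*-monomial c 1 e n) (cong (λ d → monomial d e n) (*-identityʳ c))))

  monomial-^ : ∀ q w → monomial 1 q ^ₚ w ≈ monomial 1 (w * q)
  monomial-^ q zero    _ = refl
  monomial-^ q (suc w) n = trans (conv-cong (λ _ → refl) (monomial-^ q w) n)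
                                 (cong (_% p) (conv-monomial-monomial 1 1 q (w * q) n))

  monomial-product : ∀ n (c e : Fin n → ℕ) →
    product (tabulate (λ i → monomial (c i) (e i))) ≈ monomial (vprod (tabulate c)) (vsum (tabulate e))
  monomial-product zero    c e _ = refl
  monomial-product (suc n) c e = ≈-trans (conv-cong (λ _ → refl) (monomial-product n (c ∘ fsuc) (e ∘ fsuc)))
    (≡⇒≈ (conv-monomial-monomial (c fzero) _ (e fzero) _))

  lsum-coeff : ∀ {A : Set} (g : A → Poly) xs n → lsum (L.map g xs) n ≡ sum (L.map (λ a → g a n) xs)
  lsum-coeff g []       n = refl
  lsum-coeff g (x ∷ xs) n = cong (g x n +_) (lsum-coeff g xs n)

  sum-monomials-at : ∀ {A : Set} (c e : A → ℕ) n (≡n? : Decidable (λ x → e x ≡ n)) xs →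
    sum (L.map (λ x → monomial (c x) (e x) n) xs) ≡ sum (L.map c (filter ≡n? xs))
  sum-monomials-at c e n ≡n? []       = refl
  sum-monomials-at c e n ≡n? (x ∷ xs) with ≡n? x
  ... | yes e≡n = cong₂ _+_ (trans (cong (monomial (c x) (e x)) (sym e≡n)) (monomial-≡ (c x) (e x)))
                            (sum-monomials-at c e n ≡n? xs)
  ... | no  e≢n = cong₂ _+_ (monomial-≢ (c x) (e x) n e≢n) (sum-monomials-at c e n ≡n? xs)

  family-monomial : ∀ {t} (F : Fam p t) (a b : ℕ → ℕ) →
    product (tabulate (λ i → product (tabulate (λ j →
      monomial (piK (lookup (lookup F i) j) (a (toℕ i)) (b (toℕ j)))
               (weight (lookup (lookup F i) j) * p ^ (toℕ i + toℕ j))))))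
    ≈ monomial (piFam {p} {t} F (digitVec a t) (digitVec b t)) (normFam p F)
  family-monomial {t} F a b = ≈-trans (product-cong (suc t) (λ i → monomial-product (suc t) (c i) (e i)))
    (≈-trans (monomial-product (suc t) (λ i → vprod (tabulate (c i))) (λ i → vsum (tabulate (e i))))
      (≡⇒≈ (λ n → cong (λ d → monomial d (normFam p F) n)
        (cong vprod (tabulate-cong (λ i → cong vprod (tabulate-cong (λ j →
          cong₂ (piK (lookup (lookup F i) j)) (sym (lookup∘tabulate (a ∘ toℕ) i)) (sym (lookup∘tabulate (b ∘ toℕ) j))))))))))
    where
    c e : Fin (suc t) → Fin (suc t) → ℕ
    c i j = piK (lookup (lookup F i) j) (a (toℕ i)) (b (toℕ j))
    e i j = weight (lookup (lookup F i) j) * p ^ (toℕ i + toℕ j)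

  1+X : Poly
  1+X = 𝟙 ⊕ monomial 1 1

  1+X^_ : ℕ → Poly
  1+X^ q = 𝟙 ⊕ monomial 1 q

  [1+X]^n≡C : ∀ n k → (1+X ^ₚ n) k ≡ n C k
  [1+X]^n≡C zero    zero    = refl
  [1+X]^n≡C zero    (suc k) = refl
  [1+X]^n≡C (suc n) zero    = trans (+-identityʳ _) ([1+X]^n≡C n 0)
  [1+X]^n≡C (suc n) (suc k) = begin
    conv 1+X P (suc k)              ≡⟨ cong₂ _+_ (+-identityʳ (P (suc k))) (trans (conv-congˡ P (λ _ → refl) k) (conv-identityˡ P k)) ⟩
    P (suc k) + P k                 ≡⟨ cong₂ _+_ ([1+X]^n≡C n (suc k)) ([1+X]^n≡C n k) ⟩
    n C suc k + n C k               ≡⟨ +-comm (n C suc k) (n C k) ⟩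
    n C k + n C suc k               ≡⟨ nCk+nC[k+1]≡[n+1]C[k+1] n k ⟩
    suc n C suc k                   ∎
    where
    open ≡-Reasoning
    P : Poly
    P = 1+X ^ₚ n

  [1+X^q]^R-below-q : ∀ q R i → i < q → ((1+X^ q) ^ₚ R) i ≡ 𝟙 i
  [1+X^q]^R-below-q q zero    i i<q = refl
  [1+X^q]^R-below-q q (suc R) i i<q = begin
    conv (1+X^ q) G i                              ≡⟨ conv-distribʳ 𝟙 (monomial 1 q) G i ⟩
    conv 𝟙 G i + conv (monomial 1 q) G i           ≡⟨ cong₂ _+_ (conv-identityˡ G i) (conv-monomial-< 1 q G i i<q) ⟩
    G i + 0                                        ≡⟨ +-identityʳ (G i) ⟩
    G i                                            ≡⟨ [1+X^q]^R-below-q q R i i<q ⟩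
    𝟙 i                                            ∎
    where
    open ≡-Reasoning
    G : Poly
    G = (1+X^ q) ^ₚ R

  conv-[1+X^q]^R-below-q : ∀ f q R n → n < q → conv f ((1+X^ q) ^ₚ R) n ≡ f n
  conv-[1+X^q]^R-below-q f q R n n<q =
    trans (conv-congʳ-≤ f n (λ i i≤n → [1+X^q]^R-below-q q R i (≤-<-trans i≤n n<q)))
          (trans (conv-comm f 𝟙 n) (conv-identityˡ f n))

  [1+X^q]^e-at-q : ∀ q e → 0 < q → ((1+X^ q) ^ₚ e) q ≡ e
  [1+X^q]^e-at-q q zero    0<q = monomial-≢ 1 0 q (λ 0≡q → <-irrefl 0≡q 0<q)
  [1+X^q]^e-at-q q (suc e) 0<q = begin
    conv (1+X^ q) G q                              ≡⟨ conv-distribʳ 𝟙 (monomial 1 q) G q ⟩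
    conv 𝟙 G q + conv (monomial 1 q) G q           ≡⟨ cong₂ _+_ (conv-identityˡ G q) (cong (conv (monomial 1 q) G) (sym (+-identityʳ q))) ⟩
    G q + conv (monomial 1 q) G (q + 0)            ≡⟨ cong₂ _+_ ([1+X^q]^e-at-q q e 0<q) (conv-monomial 1 q G 0) ⟩
    e + 1 * G 0                                    ≡⟨ cong (λ c → e + 1 * c) ([1+X^q]^R-below-q q e 0 0<q) ⟩
    e + 1                                          ≡⟨ +-comm e 1 ⟩
    suc e                                          ∎
    where
    open ≡-Reasoning
    G : Poly
    G = (1+X^ q) ^ₚ e

  [1+X]^E*[1+X^q]^e-at-q : ∀ {q} E e → E < q → conv (1+X ^ₚ E) ((1+X^ q) ^ₚ e) q ≡ e
  [1+X]^E*[1+X^q]^e-at-q {suc m} E e E<q = begin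
    conv F G (suc m)                               ≡⟨ conv-comm F G (suc m) ⟩
    G 0 * F (suc m) + conv (G ∘ suc) F m           ≡⟨ cong₂ _+_ (cong (G 0 *_) (trans ([1+X]^n≡C E (suc m)) (k>n⇒nCk≡0 E<q)))
                                                       (conv-last (G ∘ suc) F m (λ i i<m → [1+X^q]^R-below-q (suc m) e (suc i) (s≤s i<m))) ⟩
    G 0 * 0 + G (suc m) * F 0                      ≡⟨ cong₂ _+_ (*-zeroʳ (G 0)) (cong₂ _*_ ([1+X^q]^e-at-q (suc m) e (s≤s z≤n)) ([1+X]^n≡C E 0)) ⟩
    e * 1                                          ≡⟨ *-identityʳ e ⟩
    e                                              ∎
    where
    open ≡-Reasoning
    F G : Poly
    F = 1+X ^ₚ E
    G = (1+X^ (suc m)) ^ₚ e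

  module _ (prime : Prime p) where

    [p^s]Ck≡ₚ[1+X^p^s] : ∀ s {n} → suc n ≡ p ^ s → ∀ k → suc n C k ≡ₚ (1+X^ (suc n)) k
    [p^s]Ck≡ₚ[1+X^p^s] s 1+n≡p^s zero    = refl
    [p^s]Ck≡ₚ[1+X^p^s] s {n} 1+n≡p^s (suc k) with <-cmp k n
    ... | tri< k<n _ _ = trans (n∣m⇒m%n≡0 _ p (p∣[p^s]C[1+k] prime s 1+n≡p^s k<n))
                               (trans (sym (m*n%n≡0 0 p)) (cong (_% p) (sym (monomial-≢ 1 n k (λ n≡k → <-irrefl (sym n≡k) k<n)))))
    ... | tri≈ _ refl _ = cong (_% p) (trans (nCn≡1 (suc k)) (sym (monomial-≡ 1 k)))
    ... | tri> _ _ n<k  = cong (_% p) (trans (k>n⇒nCk≡0 (s≤s n<k)) (sym (monomial-≢ 1 n k (λ n≡k → <-irrefl n≡k n<k))))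

    frobenius : ∀ s → 1+X ^ₚ (p ^ s) ≈ 1+X^ (p ^ s)
    frobenius s with p ^ s in p^s≡q
    ... | zero  = contradiction p^s≡q (≢-nonZero⁻¹ (p ^ s) {{m^n≢0 p s}})
    ... | suc n = λ k → trans (cong (_% p) ([1+X]^n≡C (suc n) k)) ([p^s]Ck≡ₚ[1+X^p^s] s (sym p^s≡q) k)

    [1+X]^[M+p^s*R] : ∀ s M R → 1+X ^ₚ (M + p ^ s * R) ≈ conv (1+X ^ₚ M) ((1+X^ (p ^ s)) ^ₚ R)
    [1+X]^[M+p^s*R] s M R = ≈-trans (^-homo-* 1+X M (p ^ s * R))
      (conv-cong (λ _ → refl) (≈-trans (≈-sym (^-assocʳ 1+X (p ^ s) R)) (^-congˡ R (frobenius s))))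

    [M+p^s*R]Cn≡ₚMCn : ∀ s M R n → n < p ^ s → (M + p ^ s * R) C n ≡ₚ M C n
    [M+p^s*R]Cn≡ₚMCn s M R n n<p^s = begin
      ((M + p ^ s * R) C n) % p                       ≡⟨ cong (_% p) ([1+X]^n≡C (M + p ^ s * R) n) ⟨
      (1+X ^ₚ (M + p ^ s * R)) n % p                 ≡⟨ [1+X]^[M+p^s*R] s M R n ⟩
      conv (1+X ^ₚ M) ((1+X^ (p ^ s)) ^ₚ R) n % p    ≡⟨ cong (_% p) (conv-[1+X^q]^R-below-q (1+X ^ₚ M) (p ^ s) R n n<p^s) ⟩
      (1+X ^ₚ M) n % p                               ≡⟨ cong (_% p) ([1+X]^n≡C M n) ⟩
      (M C n) % p                                    ∎
      where open ≡-Reasoning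

    [E+p^t*e]C[p^t]≡ₚe : ∀ t E e → E < p ^ t → (E + p ^ t * e) C (p ^ t) ≡ₚ e
    [E+p^t*e]C[p^t]≡ₚe t E e E<p^t = begin
      ((E + p ^ t * e) C (p ^ t)) % p                        ≡⟨ cong (_% p) ([1+X]^n≡C (E + p ^ t * e) (p ^ t)) ⟨
      (1+X ^ₚ (E + p ^ t * e)) (p ^ t) % p                   ≡⟨ [1+X]^[M+p^s*R] t E e (p ^ t) ⟩
      conv (1+X ^ₚ E) ((1+X^ (p ^ t)) ^ₚ e) (p ^ t) % p      ≡⟨ cong (_% p) ([1+X]^E*[1+X^q]^e-at-q E e E<p^t) ⟩
      e % p                                                  ∎
      where open ≡-Reasoning

    [1+X]^[p^s*x*y] : ∀ s {x y} → x < p → y < p →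
      1+X ^ₚ (p ^ s * (x * y)) ≈ lsum (L.map (λ k → monomial (piK k x y) (weight k * p ^ s)) (KList p))
    [1+X]^[p^s*x*y] s {x} {y} x<p y<p = begin
      1+X ^ₚ (p ^ s * (x * y))              ≈⟨ ^-assocʳ 1+X (p ^ s) (x * y) ⟨
      (1+X ^ₚ p ^ s) ^ₚ (x * y)             ≈⟨ ^-congˡ (x * y) (frobenius s) ⟩
      (1+X^ (p ^ s)) ^ₚ (x * y)             ≈⟨ ^-assocʳ (1+X^ (p ^ s)) x y ⟨
      ((1+X^ (p ^ s)) ^ₚ x) ^ₚ y            ≈⟨ multinomial-theorem x (monomial 1 (p ^ s)) x<p y<p ⟩
      lsum (L.map (λ k → piK k x y × monomial 1 (p ^ s) ^ₚ weight k) (KList p))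
        ≈⟨ lsum-cong (KList p) (λ k → ≈-trans (×-congʳ (piK k x y) (monomial-^ (p ^ s) (weight k)))
                                              (×-monomial (piK k x y) (weight k * p ^ s))) ⟩
      lsum (L.map (λ k → monomial (piK k x y) (weight k * p ^ s)) (KList p)) ∎
      where open ≈-Reasoning

    p^t<p^[1+t] : ∀ t → p ^ t < p ^ suc t
    p^t<p^[1+t] t = ^-monoʳ-< p (nonTrivial⇒n>1 p {{prime⇒nonTrivial prime}}) (n<1+n t)

    digit≡ₚ[digitSum]C[p^t] : ∀ {m t} d → (∀ i → i ≤ m → d i < p) → t ≤ m → d t ≡ₚ (digitSum p m d) C (p ^ t)
    digit≡ₚ[digitSum]C[p^t] {m} {t} d d<p t≤m with digitSum-+ p d t (m ∸ t)
    ... | R , eq = begin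
      d t % p                                              ≡⟨ [E+p^t*e]C[p^t]≡ₚe t _ (d t) below<p^t ⟨
      ((digitSumBelow p t d + p ^ t * d t) C (p ^ t)) % p  ≡⟨ cong (λ n → (n C (p ^ t)) % p) (digitSum≡below+top p t d) ⟨
      (digitSum p t d C (p ^ t)) % p                       ≡⟨ [M+p^s*R]Cn≡ₚMCn (suc t) _ R (p ^ t) (p^t<p^[1+t] t) ⟨
      ((digitSum p t d + p ^ suc t * R) C (p ^ t)) % p     ≡⟨ cong (λ n → (n C (p ^ t)) % p) (trans (sym eq) (cong (λ n → digitSum p n d) (m+[n∸m]≡n t≤m))) ⟩
      (digitSum p m d C (p ^ t)) % p                       ∎
      where
      open ≡-Reasoning
      below<p^t : digitSumBelow p t d < p ^ t
      below<p^t = digitSumBelow<p^t p t d (λ i i<t → d<p i (≤-trans (<⇒≤ i<t) t≤m))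

    [1+X]^[AₜBₜ] : ∀ t (a b : ℕ → ℕ) → (∀ i → a i < p) → (∀ i → b i < p) →
      1+X ^ₚ (digitSum p t a * digitSum p t b) ≈
      lsum (L.map (λ F → monomial (piFam {p} {t} F (digitVec a t) (digitVec b t)) (normFam p F)) (families p t))
    [1+X]^[AₜBₜ] t a b a<p b<p = begin
      1+X ^ₚ (digitSum p t a * digitSum p t b)
        ≡⟨ cong (1+X ^ₚ_) (digitSum-*-digitSum p t a b) ⟩
      1+X ^ₚ vsum (tabulate (λ i → vsum (tabulate (N i))))
        ≈⟨ ^-vsum 1+X T (λ i → vsum (tabulate (N i))) ⟩
      product (tabulate (λ i → 1+X ^ₚ vsum (tabulate (N i))))
        ≈⟨ product-cong T (λ i → ≈-trans (^-vsum 1+X T (N i)) (product-cong T (λ j →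
             [1+X]^[p^s*x*y] (toℕ i + toℕ j) (a<p (toℕ i)) (b<p (toℕ j))))) ⟩
      product (tabulate (λ i → product (tabulate (λ j → lsum (L.map (g i j) (KList p))))))
        ≈⟨ product-cong T (λ i → product-of-lsums (KList p) T (g i)) ⟩
      product (tabulate (λ i → lsum (L.map (λ row → product (tabulate (λ j → g i j (lookup row j)))) (vecsOver (KList p) T))))
        ≈⟨ product-of-lsums (vecsOver (KList p) T) T (λ i row → product (tabulate (λ j → g i j (lookup row j)))) ⟩
      lsum (L.map (λ F → product (tabulate (λ i → product (tabulate (λ j → g i j (lookup (lookup F i) j)))))) (families p t))
        ≈⟨ lsum-cong (families p t) (λ F → family-monomial F a b) ⟩
      lsum (L.map (λ F → monomial (piFam {p} {t} F (digitVec a t) (digitVec b t)) (normFam p F)) (families p t)) ∎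
      where
      open ≈-Reasoning
      T : ℕ
      T = suc t
      N : Fin T → Fin T → ℕ
      N i j = p ^ (toℕ i + toℕ j) * (a (toℕ i) * b (toℕ j))
      g : Fin T → Fin T → Vec ℕ (p ∸ 1) → Poly
      g i j k = monomial (piK k (a (toℕ i)) (b (toℕ j))) (weight k * p ^ (toℕ i + toℕ j))

    [AₜBₜ]C[p^t]≡ₚrhsSum : ∀ t (a b : ℕ → ℕ) → (∀ i → a i < p) → (∀ i → b i < p) →
      (digitSum p t a * digitSum p t b) C (p ^ t) ≡ₚ rhsSum p t (digitVec a t) (digitVec b t)
    [AₜBₜ]C[p^t]≡ₚrhsSum t a b a<p b<p = begin
      ((digitSum p t a * digitSum p t b) C (p ^ t)) % p      ≡⟨ cong (_% p) ([1+X]^n≡C _ (p ^ t)) ⟨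
      (1+X ^ₚ (digitSum p t a * digitSum p t b)) (p ^ t) % p ≡⟨ [1+X]^[AₜBₜ] t a b a<p b<p (p ^ t) ⟩
      lsum (L.map F↦monomial (families p t)) (p ^ t) % p     ≡⟨ cong (_% p) (lsum-coeff F↦monomial (families p t) (p ^ t)) ⟩
      sum (L.map (λ F → F↦monomial F (p ^ t)) (families p t)) % p
        ≡⟨ cong (_% p) (sum-monomials-at (λ F → piFam {p} {t} F xs ys) (normFam p) (p ^ t) (λ F → normFam p F ≟ p ^ t) (families p t)) ⟩
      rhsSum p t xs ys % p                                   ∎
      where
      open ≡-Reasoning
      xs ys : Vec ℕ (suc t)
      xs = digitVec a t
      ys = digitVec b t
      F↦monomial : Fam p t → Poly
      F↦monomial F = monomial (piFam {p} {t} F xs ys) (normFam p F)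

open import Defs
open import Data.Nat using (ℕ; suc; _+_; _*_; _^_; _<_; _≤_; _%_; NonZero; z≤n)
open import Data.Nat.Combinatorics using (_C_; nC1≡n)
open import Data.Nat.Primality using (Prime)
open import Data.Product using (_×_; _,_)
open import Relation.Binary.PropositionalEquality using (_≡_; sym; trans; cong; cong₂)

lemma4p3 : (p : ℕ) → Prime p → .{{_ : NonZero p}} → (r : ℕ) → (a b e : ℕ → ℕ)
    → (∀ i → i ≤ r → a i < p) → (∀ i → i ≤ r → b i < p)
    → (∀ i → r < i → a i ≡ 0) → (∀ i → r < i → b i ≡ 0)
    → (∀ i → i ≤ 2 * r + 1 → e i < p)
    → digitSum p r a * digitSum p r b ≡ digitSum p (2 * r + 1) e
    → (e 0 % p ≡ (a 0 * b 0) % p)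
      × (∀ t → 1 ≤ t → t ≤ 2 * r + 1
           → e t % p ≡ rhsSum p t (digitVec a t) (digitVec b t) % p)
lemma4p3 p p-prime r a b e a<p b<p a≡0 b≡0 e<p AB≡E = e₀≡ₚa₀b₀ , eₜ≡ₚrhsSum
  where
  open PolynomialsModP p
  open Digits

  eₜ≡ₚ[AₜBₜ]C[p^t] : ∀ t → t ≤ 2 * r + 1 → e t ≡ₚ (digitSum p t a * digitSum p t b) C (p ^ t)
  eₜ≡ₚ[AₜBₜ]C[p^t] t t≤2r+1 with digitSum-*-mod-p^[1+t] p a b r a≡0 b≡0 t
  ... | R , AB≡AₜBₜ+p^[1+t]R = trans (digit≡ₚ[digitSum]C[p^t] p-prime e e<p t≤2r+1)
    (trans (cong (λ n → (n C (p ^ t)) % p) (trans (sym AB≡E) AB≡AₜBₜ+p^[1+t]R))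
           ([M+p^s*R]Cn≡ₚMCn p-prime (suc t) _ R (p ^ t) (p^t<p^[1+t] p-prime t)))

  e₀≡ₚa₀b₀ : e 0 % p ≡ (a 0 * b 0) % p
  e₀≡ₚa₀b₀ = trans (eₜ≡ₚ[AₜBₜ]C[p^t] 0 z≤n)
    (cong (_% p) (trans (nC1≡n _) (cong₂ _*_ (digitSum-zero p a) (digitSum-zero p b))))

  eₜ≡ₚrhsSum : ∀ t → 1 ≤ t → t ≤ 2 * r + 1 → e t % p ≡ rhsSum p t (digitVec a t) (digitVec b t) % p
  eₜ≡ₚrhsSum t _ t≤2r+1 = trans (eₜ≡ₚ[AₜBₜ]C[p^t] t t≤2r+1)
    ([AₜBₜ]C[p^t]≡ₚrhsSum p-prime t a b (digit<p a a<p a≡0) (digit<p b b<p b≡0))
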